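{- Let $M_\mu=\langle W,\mu,\mathcal{F},V\rangle$ be a gtf-model. For $w\in W$ let $\mathcal{N}^\mu_w=\{X\subseteq\bigcup\mu:\text{there is }O\in\mathcal{F}_w\text{ with }O\subseteq X\}$. Then $M=\langle W,\mathcal{N}^\mu,V\rangle$ is a gtn-model which is pointwise equivalent to $M_\mu$, i.e. for every $w\in W$ and every formula $\varphi$, $w\Vdash_\mu\varphi$ in $M_\mu$ iff $w\Vdash\varphi$ in $M$.
   Context: Formulas are built from a countable set $PV$ of propositional variables using $\bot,\lnot,\land,\lor,\to,\Box$. A generalized topology on a nonempty set $W$ is a family $\mu\subseteq P(W)$ with $\emptyset\in\mu$ and closed under unions of arbitrary nonempty subfamilies; $\bigcup\mu$ is the union of all members of $\mu$. A gtf-model is $\langle W,\mu,\mathcal{F},V\rangle$ where $\mu$ is a generalized topology on $W$, $V:PV\to P(W)$, and $\mathcal{F}:W\to P(P(\bigcup\mu))$ (write $\mathcal{F}_w$) satisfies: if $w\in\bigcup\mu$ then for every $X$, $X\in\mathcal{F}_w$ iff ($X\in\mu$ and $w\in X$); if $w\in W\setminus\bigcup\mu$ then every $X\in\mathcal{F}_w$ belongs to $\mu$. Satisfaction $\Vdash_\mu$: $w\Vdash_\mu q$ iff $w\in V(q)$; Boolean clauses classical; $w\Vdash_\mu\Box\varphi$ iff there is $O\in\mathcal{F}_w$ with $v\Vdash_\mu\varphi$ for all $v\in O$. A gtn-model is $\langle W,\mathcal{N},V\rangle$ with $V:PV\to P(W)$ and $\mathcal{N}:W\to P(P(W))$ such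 that, writing $\bigcup\mathcal{N}$ for the union of all sets $X$ with $X\in\mathcal{N}_w$ for some $w\in W$: (1) $W=W_1\cup W_2$ where $W_1=\{z\in W: z\in\bigcap\mathcal{N}_z\}$ and $W_2=\{z\in W:z\notin\bigcup\mathcal{N}\}$, where $z\in\bigcap\mathcal{N}_z$ means that $\mathcal{N}_z\neq\emptyset$ and $z$ belongs to every member of $\mathcal{N}_z$; (2) if $X\in\mathcal{N}_w$ and $X\subseteq Y\subseteq\bigcup\mathcal{N}$ then $Y\in\mathcal{N}_w$; (3) if $X\in\mathcal{N}_w$ then $\{z\in W_1: X\in\mathcal{N}_z\}\in\mathcal{N}_w$. Satisfaction: Boolean clauses classical, $w\Vdash q$ iff $w\in V(q)$, and $w\Vdash\Box\varphi$ iff there is $X\in\mathcal{N}_w$ with $X\subseteq\{z:z\Vdash\varphi\}$. -}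

module Defs where

open import Level using (Level) renaming (suc to lsuc; zero to lzero)
open import Data.Nat using (ℕ)
open import Data.Empty using (⊥)
open import Data.Product using (Σ; ∃; _×_; _,_)
open import Data.Sum using (_⊎_)
open import Relation.Nullary using (¬_)
open import Function.Bundles using (_⇔_)

Sub : Set → Set₁
Sub W = W → Set

Fam : Set → Set₂
Fam W = Sub W → Set₁

_⊆_ : {W : Set} → (W → Set) → (W → Set₁) → Set₁
X ⊆ Y = ∀ w → X w → Y w

_≐_ : {W : Set} → Sub W → (W → Set₁) → Set₁
Y ≐ S = ∀ w → Y w ⇔ S w

lift₁ : {W : Set} → Sub W → (W → Set₁)
lift₁ X w = Level.Lift (lsuc lzero) (X w)

∅ : {W : Set} → Sub W
∅ _ = ⊥

⋃ : {W : Set} → Fam W → (W → Set₁)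
⋃ {W} 𝒮 w = Σ (Sub W) λ X → 𝒮 X × X w

-- Generalized topology: ∅ ∈ μ, closed under unions of arbitrary nonempty
-- subfamilies ("the union belongs to μ" = some member of μ equals it).
record IsGT (W : Set) (μ : Fam W) : Set₂ where
  field
    empty∈ : μ ∅
    unions : (𝒮 : Fam W) → (∀ X → 𝒮 X → μ X) → (Σ (Sub W) 𝒮) →
             Σ (Sub W) λ Y → μ Y × (Y ≐ ⋃ 𝒮)

record IsGTFModel (W : Set) (μ : Fam W) (F : W → Fam W) : Set₂ where
  field
    nonempty : W
    isGT     : IsGT W μ
    F⊆P⋃μ    : ∀ w X → F w X → X ⊆ ⋃ μ
    F-in     : ∀ w → ⋃ μ w → ∀ X → (F w X ⇔ (μ X × X w))
    F-out    : ∀ w → ¬ ⋃ μ w → ∀ X → F w X → μ X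

⋃N : {W : Set} → (W → Fam W) → (W → Set₁)
⋃N {W} N z = Σ W λ w → Σ (Sub W) λ X → N w X × X z

W₁ : {W : Set} → (W → Fam W) → (W → Set₁)
W₁ {W} N z = (Σ (Sub W) (N z)) × (∀ X → N z X → X z)

W₂ : {W : Set} → (W → Fam W) → (W → Set₁)
W₂ N z = ¬ ⋃N N z

record IsGTNModel (W : Set) (N : W → Fam W) : Set₂ where
  field
    cover  : ∀ z → W₁ N z ⊎ W₂ N z
    upward : ∀ w X Y → N w X → (∀ z → X z → Y z) → Y ⊆ ⋃N N → N w Y
    cond3  : ∀ w X → N w X →
             Σ (Sub W) λ Y → N w Y × (Y ≐ λ z → W₁ N z × N z X)

data Form : Set where
  var  : ℕ → Form
  ⊥'   : Form
  ¬'_  : Form → Form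
  _∧'_ : Form → Form → Form
  _∨'_ : Form → Form → Form
  _→'_ : Form → Form → Form
  □_   : Form → Form

satF : {W : Set} → Fam W → (W → Fam W) → (ℕ → Sub W) → W → Form → Set₁
satF μ F V w (var q)  = lift₁ (V q) w
satF μ F V w ⊥'       = Level.Lift _ ⊥
satF μ F V w (¬' φ)   = ¬ satF μ F V w φ
satF μ F V w (φ ∧' ψ) = satF μ F V w φ × satF μ F V w ψ
satF μ F V w (φ ∨' ψ) = satF μ F V w φ ⊎ satF μ F V w ψ
satF μ F V w (φ →' ψ) = satF μ F V w φ → satF μ F V w ψ
satF {W} μ F V w (□ φ) = Σ (Sub W) λ O → F w O × (∀ v → O v → satF μ F V v φ)

satN : {W : Set} → (W → Fam W) → (ℕ → Sub W) → W → Form → Set₁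
satN N V w (var q)  = lift₁ (V q) w
satN N V w ⊥'       = Level.Lift _ ⊥
satN N V w (¬' φ)   = ¬ satN N V w φ
satN N V w (φ ∧' ψ) = satN N V w φ × satN N V w ψ
satN N V w (φ ∨' ψ) = satN N V w φ ⊎ satN N V w ψ
satN N V w (φ →' ψ) = satN N V w φ → satN N V w ψ
satN {W} N V w (□ φ) = Σ (Sub W) λ X → N w X × (∀ z → X z → satN N V z φ)

Nμ : {W : Set} → Fam W → (W → Fam W) → W → Fam W
Nμ {W} μ F w X = (X ⊆ ⋃ μ) × Σ (Sub W) λ O → F w O × (∀ z → O z → X z)

-- Truth is preserved because every member of 𝒩^μ_w contains some O ∈ F_w, and a
-- □-witness can be shrunk to that O (conversely O itself is in 𝒩^μ_w).  For the
-- gtn-conditions, a point of ⋃μ has as neighbourhoods exactly the supersets of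
-- open sets containing it, so it lies in W₁, while a point outside ⋃μ lies in
-- no neighbourhood at all, so it lies in W₂; the set required by condition (3)
-- for X ∈ 𝒩^μ_w is the μ-interior of X, which exists by closure of μ under
-- unions and belongs to 𝒩^μ_w because it contains an O ∈ F_w.
module Submission where

open import Defs
open import Level using (0ℓ)
open import Axiom.ExcludedMiddle using (ExcludedMiddle)
open import Data.Nat using (ℕ)
open import Data.Product using (_×_; _,_; Σ; proj₁; proj₂)
open import Data.Sum using (_⊎_; inj₁; inj₂)
open import Data.Product.Function.NonDependent.Propositional using (_×-⇔_)
open import Data.Sum.Function.Propositional using (_⊎-⇔_)
open import Function.Bundles using (_⇔_; mk⇔; Equivalence)
open import Function.Construct.Identity using (⇔-id)
open import Function.Construct.Composition using (_⇔-∘_)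
open import Function.Construct.Symmetry using (⇔-sym)
open import Function.Related.TypeIsomorphisms using (→-cong-⇔; ¬-cong-⇔)
open import Relation.Nullary using (yes; no)

open Equivalence using (to; from)

openSubsetsOf : {W : Set} → Fam W → Sub W → Fam W
openSubsetsOf μ X O = μ O × (∀ z → O z → X z)

μ⊆⋃μ : {W : Set} {μ : Fam W} {X : Sub W} → μ X → X ⊆ ⋃ μ
μ⊆⋃μ {X = X} μX z Xz = X , μX , Xz

module _ {W : Set} {μ : Fam W} {F : W → Fam W} where

  ⋃Nμ⊆⋃μ : ∀ z → ⋃N (Nμ μ F) z → ⋃ μ z
  ⋃Nμ⊆⋃μ z (_ , X , (X⊆⋃μ , _) , Xz) = X⊆⋃μ z Xz

  Nμ-upward : ∀ w X Y → Nμ μ F w X → (∀ z → X z → Y z) → Y ⊆ ⋃N (Nμ μ F) →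
              Nμ μ F w Y
  Nμ-upward w X Y (_ , O , FO , O⊆X) X⊆Y Y⊆⋃N =
    (λ z Yz → ⋃Nμ⊆⋃μ z (Y⊆⋃N z Yz)) , O , FO , λ z Oz → X⊆Y z (O⊆X z Oz)

  □-F⇔□-Nμ : (∀ w O → F w O → O ⊆ ⋃ μ) → ∀ w (P : W → Set₁) →
             (Σ (Sub W) λ O → F w O × (∀ z → O z → P z)) ⇔
             (Σ (Sub W) λ X → Nμ μ F w X × (∀ z → X z → P z))
  □-F⇔□-Nμ F⊆⋃μ w P = mk⇔
    (λ { (O , FO , O⊆P) → O , (F⊆⋃μ w O FO , O , FO , λ _ Oz → Oz) , O⊆P })
    (λ { (X , (_ , O , FO , O⊆X) , X⊆P) → O , FO , λ z Oz → X⊆P z (O⊆X z Oz) })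

  satF⇔satN : (∀ w O → F w O → O ⊆ ⋃ μ) → (V : ℕ → Sub W) →
              ∀ w φ → satF μ F V w φ ⇔ satN (Nμ μ F) V w φ
  satF⇔satN F⊆⋃μ V = go
    where
    go : ∀ w φ → satF μ F V w φ ⇔ satN (Nμ μ F) V w φ
    go w (var q)  = ⇔-id _
    go w ⊥'       = ⇔-id _
    go w (¬' φ)   = ¬-cong-⇔ (go w φ)
    go w (φ ∧' ψ) = go w φ ×-⇔ go w ψ
    go w (φ ∨' ψ) = go w φ ⊎-⇔ go w ψ
    go w (φ →' ψ) = →-cong-⇔ (go w φ) (go w ψ)
    go w (□ φ)    = □-F⇔□-Nμ F⊆⋃μ w (λ z → satN (Nμ μ F) V z φ) ⇔-∘ mk⇔
      (λ { (O , FO , O⊆φ) → O , FO , λ z Oz → to (go z φ) (O⊆φ z Oz) })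
      (λ { (O , FO , O⊆φ) → O , FO , λ z Oz → from (go z φ) (O⊆φ z Oz) })

module _ {W : Set} {μ : Fam W} {F : W → Fam W} (G : IsGTFModel W μ F) where
  open IsGTFModel G

  ⋃μ⇒W₁ : ∀ z → ⋃ μ z → W₁ (Nμ μ F) z
  ⋃μ⇒W₁ z z∈⋃μ@(X , μX , Xz) =
    (X , μ⊆⋃μ μX , X , from (F-in z z∈⋃μ X) (μX , Xz) , λ _ Xv → Xv) ,
    λ { Y (_ , O , FO , O⊆Y) → O⊆Y z (proj₂ (to (F-in z z∈⋃μ O) FO)) }

  W₁⇒⋃μ : ∀ z → W₁ (Nμ μ F) z → ⋃ μ z
  W₁⇒⋃μ z ((X , X∈Nμz@(X⊆⋃μ , _)) , z∈all) = X⊆⋃μ z (z∈all X X∈Nμz)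

  W₁×Nμ⇔openSubset∋ : ∀ X → X ⊆ ⋃ μ → ∀ z →
    (W₁ (Nμ μ F) z × Nμ μ F z X) ⇔ (Σ (Sub W) λ O → openSubsetsOf μ X O × O z)
  W₁×Nμ⇔openSubset∋ X X⊆⋃μ z = mk⇔
    (λ { (z∈W₁ , _ , O , FO , O⊆X) →
         let (μO , Oz) = to (F-in z (W₁⇒⋃μ z z∈W₁) O) FO
         in O , (μO , O⊆X) , Oz })
    (λ { (O , (μO , O⊆X) , Oz) →
         let z∈⋃μ = O , μO , Oz
         in ⋃μ⇒W₁ z z∈⋃μ , X⊆⋃μ , O , from (F-in z z∈⋃μ O) (μO , Oz) , O⊆X })

  module _ (em : ExcludedMiddle (Level.suc 0ℓ)) where
    open IsGT isGT

    F⊆μ : ∀ w O → F w O → μ O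
    F⊆μ w O FO with em {⋃ μ w}
    ... | yes w∈⋃μ = proj₁ (to (F-in w w∈⋃μ O) FO)
    ... | no  w∉⋃μ = F-out w w∉⋃μ O FO

    Nμ-cover : ∀ z → W₁ (Nμ μ F) z ⊎ W₂ (Nμ μ F) z
    Nμ-cover z with em {⋃ μ z}
    ... | yes z∈⋃μ = inj₁ (⋃μ⇒W₁ z z∈⋃μ)
    ... | no  z∉⋃μ = inj₂ λ z∈⋃N → z∉⋃μ (⋃Nμ⊆⋃μ z z∈⋃N)

    Nμ-cond3 : ∀ w X → Nμ μ F w X →
               Σ (Sub W) λ Y → Nμ μ F w Y × (Y ≐ λ z → W₁ (Nμ μ F) z × Nμ μ F z X)
    Nμ-cond3 w X (X⊆⋃μ , O , FO , O⊆X)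
      with unions (openSubsetsOf μ X) (λ _ → proj₁) (O , F⊆μ w O FO , O⊆X)
    ... | intX , μintX , intX≐ =
      intX ,
      (μ⊆⋃μ μintX , O , FO ,
       λ z Oz → from (intX≐ z) (O , (F⊆μ w O FO , O⊆X) , Oz)) ,
      λ z → ⇔-sym (W₁×Nμ⇔openSubset∋ X X⊆⋃μ z) ⇔-∘ intX≐ z

    Nμ-isGTNModel : IsGTNModel W (Nμ μ F)
    Nμ-isGTNModel = record
      { cover  = Nμ-cover
      ; upward = Nμ-upward
      ; cond3  = Nμ-cond3
      }

mainTheorem3 : ExcludedMiddle (Level.suc 0ℓ) →
    (W : Set) (μ : Fam W) (F : W → Fam W) (V : ℕ → Sub W) →
    IsGTFModel W μ F →
    IsGTNModel W (Nμ μ F) ×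
    (∀ (w : W) (φ : Form) → satF μ F V w φ ⇔ satN (Nμ μ F) V w φ)
mainTheorem3 em W μ F V G =
  Nμ-isGTNModel G em , satF⇔satN (IsGTFModel.F⊆P⋃μ G) V
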